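{- Let $m\ge 0$, $k\ge 2$ be integers, $n=2^m\ge k-1$, and let $\{Q^1,\dots,Q^l\}$ be a partition of $\binom{[n]}{k-1}$ into $l$ classes such that each class $Q^i$, viewed as a $(k-1)$-uniform hypergraph on $[n]$, covers $[n]$ and contains no semicycle of length at most $k$. Let $\mathcal{F}=(U,\mathcal{D})$ be a $k$-uniform hypertree with vertex set $U=\{q_1,\dots,q_l\}$ disjoint from $[n]$. Let $V=[n]\cup U$ and $\mathcal{E}=\bigcup_{i=1}^l\{e\cup\{q_i\}: e\in Q^i\}\cup\mathcal{D}$. Then $\mathcal{H}=(V,\mathcal{E})$ is a $k$-uniform hypertree.
   Context: For $r\ge 2$, an $r$-uniform hypergraph $(V,\mathcal{E})$ (finite vertex set, edges are $r$-subsets, no multiple edges) is a chain if there is a sequence $v_1,\dots,v_l$ of its vertices in which every vertex appears at least once (possibly more times), $v_1\ne v_l$, and its edge set consists of exactly the $l-r+1$ distinct sets $\{v_i,\dots,v_{i+r-1}\}$, $1\le i\le l-r+1$; it is a semicycle if the same holds with $v_1=v_l$ instead. Length = number of edges. For $r=1$, a 1-uniform semicycle of length $t\ge 3$ is the 1-uniform (multi)hypergraph with vertex set $\{x_1,\dots,x_{t-1}\}$ and edge multiset consisting of $\{x_1\}$ with multiplicity 2 and $\{x_2\},\dots,\{x_{t-1}\}$. A hypergraph contains a semicycle if some subhypergraph of it is one. A $k$-uniform hypergraph is chain-connected if every pair of distinct vertices is contained in some subhypergraph that is a chain; semicycle-free if it contains no semicycle. A $k$-uniform hypertree is a chain-connected,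 semicycle-free $k$-uniform hypergraph. A class $Q\subseteq\binom{[n]}{k-1}$ covers $[n]$ if $\bigcup_{e\in Q}e=[n]$. -}

module Defs where

open import Data.Nat using (ℕ; zero; suc; _+_; _∸_; _≤_)
open import Data.Fin using (Fin)
open import Data.Fin.Subset using (Subset; ⁅_⁆; _∪_; ∣_∣; _∈_) renaming (⊥ to ∅)
open import Data.List using (List; []; _∷_; _++_; [_]; map; take; drop; length; upTo; foldr)
open import Data.List.Relation.Unary.All using (All)
open import Data.List.Relation.Unary.Unique.Propositional using (Unique)
import Data.List.Membership.Propositional as LM
open import Data.Vec using () renaming (_++_ to _++ᵥ_)
open import Data.Product using (Σ; ∃; ∃-syntax; _×_; _,_)
open import Data.Sum using (_⊎_)
open import Relation.Binary.PropositionalEquality using (_≡_; _≢_)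
open import Relation.Nullary using (¬_)

-- A hypergraph on the finite vertex set Fin N is given by its edge set,
-- a predicate on subsets of Fin N (no multiple edges).
EdgeSet : ℕ → Set₁
EdgeSet N = Subset N → Set

Uniform : ∀ {N} → ℕ → EdgeSet N → Set
Uniform r E = ∀ e → E e → ∣ e ∣ ≡ r

toSubset : ∀ {N} → List (Fin N) → Subset N
toSubset = foldr (λ x s → ⁅ x ⁆ ∪ s) ∅

-- the sets {v_i, …, v_{i+r-1}} for 1 ≤ i ≤ l - r + 1  (l = length of the sequence)
windows : ∀ {N} → ℕ → List (Fin N) → List (Subset N)
windows r vs = map (λ i → toSubset (take r (drop i vs))) (upTo (suc (length vs ∸ r)))

-- The subhypergraph determined by the sequence vs (vertices = entries of vs,
-- edges = windows) is an r-uniform subhypergraph of E whose edge set consists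
-- of exactly l - r + 1 distinct r-sets.
WindowsOK : ∀ {N} → ℕ → EdgeSet N → List (Fin N) → Set
WindowsOK r E vs =
  r ≤ length vs × Unique (windows r vs)
  × All (λ w → ∣ w ∣ ≡ r) (windows r vs) × All E (windows r vs)

ChainIn : ∀ {N} → ℕ → EdgeSet N → List (Fin N) → Set
ChainIn {N} r E vs =
  (Σ (Fin N) λ a → Σ (Fin N) λ b → Σ (List (Fin N)) λ mid →
     vs ≡ a ∷ (mid ++ [ b ]) × a ≢ b)
  × WindowsOK r E vs

SeqSemicycle : ∀ {N} → ℕ → EdgeSet N → ℕ → Set
SeqSemicycle {N} r E t = Σ (List (Fin N)) λ vs →
  (Σ (Fin N) λ a → Σ (List (Fin N)) λ mid → vs ≡ a ∷ (mid ++ [ a ]))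
  × WindowsOK r E vs
  × t ≡ suc (length vs ∸ r)

-- E (1-uniform, simple) contains a 1-uniform semicycle of length t ≥ 3:
-- distinct vertices x1,…,x_{t-1}; edge multiset {x1},{x1},{x2},…,{x_{t-1}}
-- must be a sub-multiset of the edge set of E (every edge of E has multiplicity 1).
OneSemicycle : ∀ {N} → EdgeSet N → ℕ → Set
OneSemicycle {N} E t = Σ (Fin N) λ x₁ → Σ (List (Fin N)) λ rest →
  3 ≤ t × length rest + 2 ≡ t × Unique (x₁ ∷ rest)
  × All E (⁅ x₁ ⁆ ∷ ⁅ x₁ ⁆ ∷ map ⁅_⁆ rest)
  × Unique (⁅ x₁ ⁆ ∷ ⁅ x₁ ⁆ ∷ map ⁅_⁆ rest)

HasSemicycle : ∀ {N} → ℕ → EdgeSet N → ℕ → Set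
HasSemicycle (suc zero) E t = OneSemicycle E t
HasSemicycle r          E t = SeqSemicycle r E t

SemicycleFree : ∀ {N} → ℕ → EdgeSet N → Set
SemicycleFree r E = ∀ t → ¬ HasSemicycle r E t

ChainConnected : ∀ {N} → ℕ → EdgeSet N → Set
ChainConnected {N} r E = ∀ (x y : Fin N) → x ≢ y →
  Σ (List (Fin N)) λ vs → ChainIn r E vs × x LM.∈ vs × y LM.∈ vs

IsHypertree : ∀ {N} → ℕ → EdgeSet N → Set
IsHypertree r E = Uniform r E × ChainConnected r E × SemicycleFree r E

Covers : ∀ {n} → EdgeSet n → Set
Covers {n} Q = ∀ (x : Fin n) → Σ (Subset n) λ e → Q e × x ∈ e

-- H on V = [n] ∪ U, encoded as Fin (n + l): j ∈ [n] ↦ inject+ l j, q_i ↦ raise n i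
HEdges : ∀ {n l} → (Fin l → EdgeSet n) → EdgeSet l → EdgeSet (n + l)
HEdges {n} {l} Q D s =
  (Σ (Fin l) λ i → Σ (Subset n) λ e → Q i e × s ≡ e ++ᵥ ⁅ i ⁆)
  ⊎ (Σ (Subset l) λ d → D d × s ≡ ∅ ++ᵥ d)

module Submission where

-- Chain-connectedness: two vertices of F lie on the image of a chain of F,
-- a base vertex a and q_j lie on an edge e ∪ {q_j} with a ∈ e (Q^j covers [n]), and two
-- base vertices lie on one edge (k ≥ 3) or on the chain a, q_i, b (k = 2).
-- Semicycle-freeness: consecutive windows of a semicycle share k - 1 vertices, which
-- forces all its edges to be of one kind, since an edge of F meets e ∪ {q_i} in at most
-- q_i, and e ∪ {q_i}, e′ ∪ {q_j} sharing k - 1 vertices have e = e′, so i = j.  Through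
-- edges of F it is a semicycle of F.

open import Defs
open import Data.Nat using (ℕ; zero; suc; _+_; _∸_; _^_; _≤_; _<_; z≤n; s≤s; _≤?_)
open import Data.Nat.Properties
  using (module ≤-Reasoning; ≤-refl; ≤-trans; ≤-reflexive; ≤-pred; ≰⇒>; <⇒≢; +-∸-assoc; m≤n⇒m∸n≡0;
         n≤1+n; <-≤-trans; m≤n+m; ≤-antisym; <⇒≤; +-cancelˡ-≡; <⇒≱; +-comm; +-identityʳ;
         m≤n+o⇒m∸n≤o; +-mono-≤)
open import Data.Bool using (true; false; _∨_; _∧_)
open import Data.Vec using ([]; _∷_; here; there) renaming (_++_ to _++ᵥ_)
open import Data.Vec.Properties
  using (lookup-++ˡ; lookup-++ʳ; []=⇒lookup; lookup⇒[]=; zipWith-++; ++-injectiveˡ; ++-injectiveʳ)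
open import Data.Fin using (Fin; zero; suc; _↑ˡ_; _↑ʳ_; splitAt; fromℕ<)
open import Data.Fin.Properties
  using (_≟_; splitAt⁻¹-↑ˡ; splitAt⁻¹-↑ʳ; splitAt-↑ˡ; splitAt-↑ʳ; ↑ˡ-injective; ↑ʳ-injective)
open import Data.Fin.Subset using (Subset; ⁅_⁆; _∪_; _∩_; ∣_∣; _∈_; _⊆_; _-_; ⊤) renaming (⊥ to ∅)
open import Data.Fin.Subset.Properties
  using (x∈p∪q⁺; x∈p∪q⁻; x∈⁅x⁆; x∈⁅y⁆⇒x≡y; ∉⊥; ∪-assoc; ∪-comm; ∪-identityʳ; ⊆-antisym; q⊆p∪q;
         p⊆q⇒∣p∣≤∣q∣; x∈p∩q⁺; ∣p∣≤∣x∷p∣; ∪-identityˡ; ∣⊥∣≡0; drop-∷-⊆; s⊆s; out⊆; ⊆⊤; ∣⊤∣≡n; p─⊥≡p;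
         p─q⊆p; x∈p∧x≢y⇒x∈p-y; ∣⁅x⁆∣≡1; Empty-unique; x∈p∩q⁻; p∩q⊆p; p∩q⊆q; ∩-zeroˡ; ∩-comm;
         ∣p∩q∣≤∣q∣; ∣p∣≤n)
open import Data.List
  using (List; []; _∷_; _++_; [_]; map; take; drop; length; applyUpTo; upTo; initLast; _∷ʳ′_)
open import Data.List.Properties
  using (map-applyUpTo; take-all; ∷-injectiveˡ; ∷-injectiveʳ; ∷ʳ-injectiveʳ; ++-assoc; map-++;
         length-++; length-++-sucʳ; ++-identityʳ; length-map; map-cong; map-∘; drop-map; take-map)
open import Data.List.Membership.Propositional using () renaming (_∈_ to _∈ₗ_; _∉_ to _∉ₗ_)
open import Data.List.Membership.Propositional.Properties using (∈-++⁻; ∈-++⁺ˡ; ∈-++⁺ʳ; ∈-map⁺; ∈-map⁻)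
open import Data.List.Relation.Unary.Any as Any using (Any; here; there)
open import Data.List.Relation.Unary.All as All using (All; []; _∷_)
import Data.List.Relation.Unary.All.Properties as All
open import Data.List.Relation.Unary.AllPairs using ([]; _∷_)
open import Data.List.Relation.Unary.Unique.Propositional using (Unique)
import Data.List.Relation.Unary.Unique.Propositional.Properties as Unique
open import Data.List.Relation.Unary.Linked using (Linked; [-]; _∷_)
open import Data.Product using (Σ; _×_; _,_; proj₁; proj₂)
open import Data.Sum using (_⊎_; inj₁; inj₂)
open import Data.Empty using (⊥; ⊥-elim)
open import Relation.Binary.PropositionalEquality
  using (_≡_; _≢_; refl; sym; trans; cong; cong₂; subst; module ≡-Reasoning)
open import Relation.Nullary using (¬_; yes; no)
open import Relation.Binary.Definitions using (DecidableEquality)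

private variable
  N M n l : ℕ

module _ {A : Set} where

  take-⊆ : ∀ r {xs : List A} {x} → x ∈ₗ take r xs → x ∈ₗ xs
  take-⊆ (suc r) {_ ∷ _} (here eq)  = here eq
  take-⊆ (suc r) {_ ∷ _} (there x∈) = there (take-⊆ r x∈)

  take-⊆-suc : ∀ r {xs : List A} {x} → x ∈ₗ take r xs → x ∈ₗ take (suc r) xs
  take-⊆-suc (suc r) {_ ∷ _} (here eq)  = here eq
  take-⊆-suc (suc r) {_ ∷ _} (there x∈) = there (take-⊆-suc r x∈)

  take-suc-snoc : ∀ r (xs : List A) → suc r ≤ length xs → Σ A λ y → take (suc r) xs ≡ take r xs ++ [ y ]
  take-suc-snoc zero    (x ∷ xs) _         = x , refl
  take-suc-snoc (suc r) (x ∷ xs) (s≤s le) with take-suc-snoc r xs le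
  ... | y , eq = y , cong (x ∷_) eq

  length-take≤ : ∀ r (xs : List A) → length (take r xs) ≤ r
  length-take≤ zero    xs       = z≤n
  length-take≤ (suc r) []       = z≤n
  length-take≤ (suc r) (x ∷ xs) = s≤s (length-take≤ r xs)

  split-first : DecidableEquality A → ∀ {x : A} xs → x ∈ₗ xs →
                Σ (List A) λ P → Σ (List A) λ S → xs ≡ P ++ x ∷ S × x ∉ₗ P
  split-first _≟_ (y ∷ ys) (here refl) = [] , ys , refl , λ ()
  split-first _≟_ {x} (y ∷ ys) (there x∈) with y ≟ x
  ... | yes refl = [] , ys , refl , λ ()
  ... | no  y≢x with split-first _≟_ ys x∈
  ...   | P , S , refl , x∉P = y ∷ P , S , refl , λ { (here x≡y) → y≢x (sym x≡y) ; (there x∈P) → x∉P x∈P }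

  ∈-insert : ∀ P {S : List A} {x z} → z ∈ₗ P ++ S → z ∈ₗ P ++ x ∷ S
  ∈-insert P z∈ with ∈-++⁻ P z∈
  ... | inj₁ z∈P = ∈-++⁺ˡ z∈P
  ... | inj₂ z∈S = ∈-++⁺ʳ P (there z∈S)

  ∉-++ : ∀ P {S : List A} {x} → x ∉ₗ P → x ∉ₗ S → x ∉ₗ P ++ S
  ∉-++ P x∉P x∉S x∈ with ∈-++⁻ P x∈
  ... | inj₁ x∈P = x∉P x∈P
  ... | inj₂ x∈S = x∉S x∈S

  Unique-head : ∀ {a b : A} {xs} → Unique (a ∷ b ∷ xs) → a ≢ b
  Unique-head ((a≢b ∷ _) ∷ _) = a≢b

  Unique-++⁻ʳ : ∀ P {S : List A} → Unique (P ++ S) → Unique S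
  Unique-++⁻ʳ []      u       = u
  Unique-++⁻ʳ (_ ∷ P) (_ ∷ u) = Unique-++⁻ʳ P u

  Linked-propagate : ∀ {R : A → A → Set} {E P : A → Set} →
    (∀ {w w'} → E w → E w' → R w w' → P w → P w') →
    ∀ {w ws} → Linked R (w ∷ ws) → All E (w ∷ ws) → P w → All P (w ∷ ws)
  Linked-propagate step [-]        (_ ∷ [])           pw = pw ∷ []
  Linked-propagate step (r ∷ link) (ew ∷ ew' ∷ edges) pw =
    pw ∷ Linked-propagate step link (ew' ∷ edges) (step ew ew' r pw)

Cyclic : {A : Set} → List A → Set
Cyclic {A} xs = Σ A λ a → Σ (List A) λ mid → xs ≡ a ∷ (mid ++ [ a ])

module _ {A : Set} where

  Cyclic-remove : ∀ P {x : A} S → Cyclic (P ++ x ∷ S) → x ∉ₗ P → x ∉ₗ S → Cyclic (P ++ S)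
  Cyclic-remove [] S (a , mid , refl) _ x∉S = ⊥-elim (x∉S (∈-++⁺ʳ mid (here refl)))
  Cyclic-remove (p ∷ P) {x} S (a , mid , eq) x∉P x∉S with initLast S
  ... | [] = ⊥-elim (x∉P (here (trans (∷ʳ-injectiveʳ (p ∷ P) (a ∷ mid) eq) (sym (∷-injectiveˡ eq)))))
  ... | S′ ∷ʳ′ s = a , P ++ S′ ,
    trans (cong (p ∷_) (sym (++-assoc P S′ [ s ]))) (cong₂ (λ u v → u ∷ (P ++ S′) ++ [ v ]) (∷-injectiveˡ eq) s≡a)
    where
    s≡a : s ≡ a
    s≡a = ∷ʳ-injectiveʳ (p ∷ P ++ x ∷ S′) (a ∷ mid) (trans (cong (p ∷_) (++-assoc P (x ∷ S′) [ s ])) eq)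

module _ {A B : Set} (f : A → B) where

  unmap : ∀ xs → (∀ {z} → z ∈ₗ xs → Σ A λ a → z ≡ f a) → Σ (List A) λ ys → xs ≡ map f ys
  unmap []       image = [] , refl
  unmap (x ∷ xs) image with image (here refl) | unmap xs (λ z∈ → image (there z∈))
  ... | a , refl | ys , refl = a ∷ ys , refl

  Cyclic-unmap : (∀ {a a′} → f a ≡ f a′ → a ≡ a′) → ∀ ys → Cyclic (map f ys) → Cyclic ys
  Cyclic-unmap f-inj (u ∷ us) (b , mid , eq) with initLast us
  ... | []        = ⊥-elim ([]≢snoc mid (∷-injectiveʳ eq))
    where
    []≢snoc : ∀ xs {x : B} → [] ≢ xs ++ [ x ]
    []≢snoc []      ()
    []≢snoc (_ ∷ _) ()
  ... | us′ ∷ʳ′ v = u , us′ , cong (λ z → u ∷ us′ ++ [ z ]) (f-inj (trans fv≡b (sym (∷-injectiveˡ eq))))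
    where
    fv≡b : f v ≡ b
    fv≡b = ∷ʳ-injectiveʳ (map f us′) mid (trans (sym (map-++ f us′ [ v ])) (∷-injectiveʳ eq))

∣⁅x⁆∪p∣≤ : ∀ (x : Fin N) p → ∣ ⁅ x ⁆ ∪ p ∣ ≤ suc ∣ p ∣
∣⁅x⁆∪p∣≤ zero    (b ∷ p)       rewrite ∪-identityˡ p = s≤s (∣p∣≤∣x∷p∣ b p)
∣⁅x⁆∪p∣≤ (suc x) (true ∷ p)  = s≤s (∣⁅x⁆∪p∣≤ x p)
∣⁅x⁆∪p∣≤ (suc x) (false ∷ p) = ∣⁅x⁆∪p∣≤ x p

∪-leftComm : ∀ (p q r : Subset N) → p ∪ (q ∪ r) ≡ q ∪ (p ∪ r)
∪-leftComm p q r = begin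
  p ∪ (q ∪ r)  ≡⟨ ∪-assoc p q r ⟨
  (p ∪ q) ∪ r  ≡⟨ cong (_∪ r) (∪-comm p q) ⟩
  (q ∪ p) ∪ r  ≡⟨ ∪-assoc q p r ⟩
  q ∪ (p ∪ r)  ∎
  where open ≡-Reasoning

⁅x⁆∪p≡p : ∀ {x : Fin N} {p} → x ∈ p → ⁅ x ⁆ ∪ p ≡ p
⁅x⁆∪p≡p {x = x} {p} x∈p = ⊆-antisym ⊆p (q⊆p∪q ⁅ x ⁆ p)
  where
  ⊆p : ⁅ x ⁆ ∪ p ⊆ p
  ⊆p y∈ with x∈p∪q⁻ ⁅ x ⁆ p y∈
  ... | inj₁ y∈x = subst (_∈ p) (sym (x∈⁅y⁆⇒x≡y x y∈x)) x∈p
  ... | inj₂ y∈p = y∈p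

⊆-size-antisym : ∀ {p q : Subset N} → p ⊆ q → ∣ q ∣ ≤ ∣ p ∣ → p ≡ q
⊆-size-antisym {p = []}        {[]}        _   _        = refl
⊆-size-antisym {p = true ∷ p}  {true ∷ q}  p⊆q (s≤s le) = cong (true ∷_) (⊆-size-antisym (drop-∷-⊆ p⊆q) le)
⊆-size-antisym {p = false ∷ p} {false ∷ q} p⊆q le       = cong (false ∷_) (⊆-size-antisym (drop-∷-⊆ p⊆q) le)
⊆-size-antisym {p = false ∷ p} {true ∷ q}  p⊆q le       = ⊥-elim (<⇒≱ (s≤s (p⊆q⇒∣p∣≤∣q∣ (drop-∷-⊆ p⊆q))) le)
⊆-size-antisym {p = true ∷ p}  {false ∷ q} p⊆q le       with p⊆q here
... | ()

extend : ∀ (s : Subset N) c → ∣ s ∣ ≤ c → c ≤ N → Σ (Subset N) λ e → s ⊆ e × ∣ e ∣ ≡ c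
extend []          zero    _        _        = [] , (λ x∈ → x∈) , refl
extend (true ∷ s)  (suc c) (s≤s le) (s≤s c≤) with extend s c le c≤
... | e , s⊆e , size = true ∷ e , s⊆s s⊆e , cong suc size
extend {suc N} (false ∷ s) c le c≤ with c ≤? N
... | yes c≤N with extend s c le c≤N
...   | e , s⊆e , size = false ∷ e , out⊆ s⊆e , size
extend {suc N} (false ∷ s) c le c≤ | no c≰N = ⊤ , ⊆⊤ , trans (∣⊤∣≡n (suc N)) (≤-antisym (≰⇒> c≰N) c≤)

⁅x⁆∩⁅y⁆≡∅ : ∀ {x y : Fin N} → x ≢ y → ⁅ x ⁆ ∩ ⁅ y ⁆ ≡ ∅
⁅x⁆∩⁅y⁆≡∅ {x = x} {y} x≢y = Empty-unique λ where
  (z , z∈) → let (z∈x , z∈y) = x∈p∩q⁻ ⁅ x ⁆ ⁅ y ⁆ z∈ in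
             x≢y (trans (sym (x∈⁅y⁆⇒x≡y x z∈x)) (x∈⁅y⁆⇒x≡y y z∈y))

elements : Subset N → List (Fin N)
elements []          = []
elements (true ∷ s)  = zero ∷ map suc (elements s)
elements (false ∷ s) = map suc (elements s)

length-elements : ∀ (s : Subset N) → length (elements s) ≡ ∣ s ∣
length-elements []          = refl
length-elements (true ∷ s)  = cong suc (trans (length-map suc (elements s)) (length-elements s))
length-elements (false ∷ s) = trans (length-map suc (elements s)) (length-elements s)

∈-elements⁺ : ∀ {s : Subset N} {x} → x ∈ s → x ∈ₗ elements s
∈-elements⁺ {s = true ∷ s}  here       = here refl
∈-elements⁺ {s = true ∷ s}  (there x∈) = there (∈-map⁺ suc (∈-elements⁺ x∈))
∈-elements⁺ {s = false ∷ s} (there x∈) = ∈-map⁺ suc (∈-elements⁺ x∈)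

∈-elements⁻ : ∀ (s : Subset N) {x} → x ∈ₗ elements s → x ∈ s
∈-elements⁻ (true ∷ s) (here refl) = here
∈-elements⁻ (true ∷ s) (there x∈) with ∈-map⁻ suc x∈
... | y , y∈ , refl = there (∈-elements⁻ s y∈)
∈-elements⁻ (false ∷ s) x∈ with ∈-map⁻ suc x∈
... | y , y∈ , refl = there (∈-elements⁻ s y∈)

∣p-x∣ : ∀ (p : Subset N) x → x ∈ p → suc ∣ p - x ∣ ≡ ∣ p ∣
∣p-x∣ (true ∷ p)  zero    here       = cong (λ q → suc ∣ q ∣) (p─⊥≡p p)
∣p-x∣ (true ∷ p)  (suc x) (there x∈) = cong suc (∣p-x∣ p x x∈)
∣p-x∣ (false ∷ p) (suc x) (there x∈) = ∣p-x∣ p x x∈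

∈-toSubset⁺ : ∀ {x : Fin N} {xs} → x ∈ₗ xs → x ∈ toSubset xs
∈-toSubset⁺ {x = x} (here refl) = x∈p∪q⁺ (inj₁ (x∈⁅x⁆ x))
∈-toSubset⁺ (there x∈xs)          = x∈p∪q⁺ (inj₂ (∈-toSubset⁺ x∈xs))

∈-toSubset⁻ : ∀ {x : Fin N} xs → x ∈ toSubset xs → x ∈ₗ xs
∈-toSubset⁻ []       x∈ = ⊥-elim (∉⊥ x∈)
∈-toSubset⁻ (y ∷ ys) x∈ with x∈p∪q⁻ ⁅ y ⁆ (toSubset ys) x∈
... | inj₁ x∈y  = here (x∈⁅y⁆⇒x≡y y x∈y)
... | inj₂ x∈ys = there (∈-toSubset⁻ ys x∈ys)

∣toSubset∣≤length : (xs : List (Fin N)) → ∣ toSubset xs ∣ ≤ length xs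
∣toSubset∣≤length {N} [] = ≤-reflexive (∣⊥∣≡0 N)
∣toSubset∣≤length (x ∷ xs) = ≤-trans (∣⁅x⁆∪p∣≤ x (toSubset xs)) (s≤s (∣toSubset∣≤length xs))

toSubset-insert : ∀ A (x : Fin N) B → toSubset (A ++ x ∷ B) ≡ ⁅ x ⁆ ∪ toSubset (A ++ B)
toSubset-insert []      x B = refl
toSubset-insert (a ∷ A) x B = trans (cong (⁅ a ⁆ ∪_) (toSubset-insert A x B))
                                    (∪-leftComm ⁅ a ⁆ ⁅ x ⁆ (toSubset (A ++ B)))

repeated⇒small : ∀ A (x : Fin N) B → x ∈ₗ A ++ B → ∣ toSubset (A ++ x ∷ B) ∣ < length (A ++ x ∷ B)
repeated⇒small A x B x∈ = begin-strict
  ∣ toSubset (A ++ x ∷ B) ∣         ≡⟨ cong ∣_∣ (toSubset-insert A x B) ⟩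
  ∣ ⁅ x ⁆ ∪ toSubset (A ++ B) ∣     ≡⟨ cong ∣_∣ (⁅x⁆∪p≡p (∈-toSubset⁺ x∈)) ⟩
  ∣ toSubset (A ++ B) ∣             ≤⟨ ∣toSubset∣≤length (A ++ B) ⟩
  length (A ++ B)                   <⟨ ≤-refl ⟩
  suc (length (A ++ B))             ≡⟨ length-++-sucʳ A x B ⟨
  length (A ++ x ∷ B)               ∎
  where open ≤-Reasoning

windows-unfold : ∀ r (xs : List (Fin N)) →
  windows r xs ≡ applyUpTo (λ i → toSubset (take r (drop i xs))) (suc (length xs ∸ r))
windows-unfold r xs = map-applyUpTo (λ i → i) _ _

windows-head : ∀ r (xs : List (Fin N)) →
  Σ (List (Subset N)) λ rest → windows r xs ≡ toSubset (take r xs) ∷ rest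
windows-head r xs = _ , windows-unfold r xs

windows-cons : ∀ r (v : Fin N) ys → r ≤ length ys →
  windows r (v ∷ ys) ≡ toSubset (take r (v ∷ ys)) ∷ windows r ys
windows-cons r v ys r≤ rewrite windows-unfold r (v ∷ ys) | windows-unfold r ys | +-∸-assoc 1 r≤ = refl

windows-short : ∀ r (xs : List (Fin N)) → length xs ≤ r → windows r xs ≡ [ toSubset xs ]
windows-short r xs ≤r rewrite windows-unfold r xs | m≤n⇒m∸n≡0 ≤r | take-all r xs ≤r = refl

windows-suffix : ∀ r (P S : List (Fin N)) → r ≤ length S →
  Σ (List (Subset N)) λ X → windows r (P ++ S) ≡ X ++ windows r S
windows-suffix r []      S r≤ = [] , refl
windows-suffix r (p ∷ P) S r≤ with windows-suffix r P S r≤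
... | X , eq = toSubset (take r (p ∷ P ++ S)) ∷ X ,
  trans (windows-cons r p (P ++ S) (≤-trans r≤ S≤)) (cong (toSubset (take r (p ∷ P ++ S)) ∷_) eq)
  where
  S≤ : length S ≤ length (P ++ S)
  S≤ = subst (length S ≤_) (sym (length-++ P)) (m≤n+m (length S) (length P))

∈-windows : ∀ r (xs : List (Fin N)) {x} → x ∈ₗ xs → Any (x ∈_) (windows (suc r) xs)
∈-windows r (v ∷ ys) x∈ with suc r ≤? length ys
... | no  short rewrite windows-short (suc r) (v ∷ ys) (≰⇒> short) = here (∈-toSubset⁺ x∈)
... | yes long  rewrite windows-cons (suc r) v ys long with x∈
...   | here refl  = here (∈-toSubset⁺ {xs = v ∷ take r ys} (here refl))
...   | there x∈ys = there (∈-windows r ys x∈ys)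

window-containing : ∀ {P : Subset N → Set} r xs {x} → All P (windows (suc r) xs) → x ∈ₗ xs →
  Σ (Subset N) λ W → P W × x ∈ W
window-containing r xs all x∈ = let i = ∈-windows r xs x∈ in Any.lookup i , All.lookupAny all i

consecutive-overlap : ∀ r (v : Fin N) ys → ∣ toSubset (take (suc r) (v ∷ ys)) ∣ ≡ suc r →
  r ≤ ∣ toSubset (take (suc r) (v ∷ ys)) ∩ toSubset (take (suc r) ys) ∣
consecutive-overlap r v ys size = ≤-trans r≤∣S∣ (p⊆q⇒∣p∣≤∣q∣ S⊆)
  where
  S = toSubset (take r ys)
  S⊆ : S ⊆ (⁅ v ⁆ ∪ S) ∩ toSubset (take (suc r) ys)
  S⊆ x∈ = x∈p∩q⁺ (q⊆p∪q ⁅ v ⁆ S x∈ , ∈-toSubset⁺ (take-⊆-suc r (∈-toSubset⁻ (take r ys) x∈)))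
  r≤∣S∣ : r ≤ ∣ S ∣
  r≤∣S∣ = ≤-pred (≤-trans (≤-reflexive (sym size)) (∣⁅x⁆∪p∣≤ v S))

windows-linked : ∀ r (xs : List (Fin N)) → All (λ w → ∣ w ∣ ≡ suc r) (windows (suc r) xs) →
  Linked (λ W W' → r ≤ ∣ W ∩ W' ∣) (windows (suc r) xs)
windows-linked r []       sizes = [-]
windows-linked r (v ∷ ys) sizes with suc r ≤? length ys
... | no  short = subst (Linked _) (sym (windows-short (suc r) (v ∷ ys) (≰⇒> short))) [-]
... | yes long  = subst (Linked _) (sym unfold) (link (windows-head (suc r) ys) (windows-linked r ys (All.tail sizes')))
  where
  unfold = windows-cons (suc r) v ys long
  sizes' = subst (All (λ w → ∣ w ∣ ≡ suc r)) unfold sizes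
  R = λ W W' → r ≤ ∣ W ∩ W' ∣
  link : (Σ (List (Subset _)) λ rest → windows (suc r) ys ≡ toSubset (take (suc r) ys) ∷ rest) →
         Linked R (windows (suc r) ys) → Linked R (toSubset (take (suc r) (v ∷ ys)) ∷ windows (suc r) ys)
  link (rest , eq) lk rewrite eq = consecutive-overlap r v ys (All.head sizes') ∷ lk

suffix-in-window : ∀ r (P S : List (Fin N)) → length S ≤ r → r ≤ length (P ++ S) →
  Σ (List (Fin N)) λ T → toSubset (T ++ S) ∈ₗ windows r (P ++ S) × length (T ++ S) ≡ r
suffix-in-window r [] S S≤ r≤ rewrite windows-short r S S≤ = [] , here refl , ≤-antisym S≤ r≤
suffix-in-window r (p ∷ P) S S≤ r≤ with r ≤? length (P ++ S)
... | yes long rewrite windows-cons r p (P ++ S) long with suffix-in-window r P S S≤ long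
...   | T , ∈ws , len = T , there ∈ws , len
suffix-in-window r (p ∷ P) S S≤ r≤ | no short
  rewrite windows-short r (p ∷ P ++ S) (≰⇒> short) = p ∷ P , here refl , ≤-antisym (≰⇒> short) r≤

take-insert : ∀ r A (x : Fin N) B → length A ≤ r →
  toSubset (take (suc r) (A ++ x ∷ B)) ≡ ⁅ x ⁆ ∪ toSubset (take r (A ++ B))
take-insert r       []      x B _         = refl
take-insert (suc r) (a ∷ A) x B (s≤s A≤) = trans (cong (⁅ a ⁆ ∪_) (take-insert r A x B A≤))
                                                 (∪-leftComm ⁅ a ⁆ ⁅ x ⁆ (toSubset (take r (A ++ B))))

windows-insert : ∀ r A (x : Fin N) B → length A ≤ r → length B ≤ r →
  windows (suc r) (A ++ x ∷ B) ≡ map (⁅ x ⁆ ∪_) (windows r (A ++ B))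
windows-insert r [] x B _ B≤ =
  trans (windows-short (suc r) (x ∷ B) (s≤s B≤)) (cong (map (⁅ x ⁆ ∪_)) (sym (windows-short r B B≤)))
windows-insert r (a ∷ A) x B A≤ B≤ with r ≤? length (A ++ B)
... | yes long = begin
  windows (suc r) (a ∷ A ++ x ∷ B)
    ≡⟨ windows-cons (suc r) a (A ++ x ∷ B) (subst (suc r ≤_) (sym (length-++-sucʳ A x B)) (s≤s long)) ⟩
  toSubset (take (suc r) (a ∷ A ++ x ∷ B)) ∷ windows (suc r) (A ++ x ∷ B)
    ≡⟨ cong₂ _∷_ (take-insert r (a ∷ A) x B A≤) (windows-insert r A x B (≤-trans (n≤1+n _) A≤) B≤) ⟩
  map (⁅ x ⁆ ∪_) (toSubset (take r (a ∷ A ++ B)) ∷ windows r (A ++ B))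
    ≡⟨ cong (map (⁅ x ⁆ ∪_)) (windows-cons r a (A ++ B) long) ⟨
  map (⁅ x ⁆ ∪_) (windows r (a ∷ A ++ B)) ∎
  where open ≡-Reasoning
... | no short = begin
  windows (suc r) (a ∷ A ++ x ∷ B)      ≡⟨ windows-short (suc r) (a ∷ A ++ x ∷ B) long≤ ⟩
  [ toSubset (a ∷ A ++ x ∷ B) ]         ≡⟨ cong [_] (toSubset-insert (a ∷ A) x B) ⟩
  [ ⁅ x ⁆ ∪ toSubset (a ∷ A ++ B) ]     ≡⟨ cong (map (⁅ x ⁆ ∪_)) (windows-short r (a ∷ A ++ B) (≰⇒> short)) ⟨
  map (⁅ x ⁆ ∪_) (windows r (a ∷ A ++ B)) ∎
  where
  open ≡-Reasoning
  long≤ : length (a ∷ A ++ x ∷ B) ≤ suc r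
  long≤ = subst (_≤ suc r) (sym (cong suc (length-++-sucʳ A x B))) (s≤s (≰⇒> short))

windows-map : ∀ (f : Fin N → Fin M) (g : Subset N → Subset M) →
  (∀ ys → toSubset (map f ys) ≡ g (toSubset ys)) →
  ∀ r xs → windows r (map f xs) ≡ map g (windows r xs)
windows-map f g f≈g r xs rewrite length-map f xs =
  trans (map-cong window≈ (upTo _)) (map-∘ (upTo _))
  where
  window≈ : ∀ i → toSubset (take r (drop i (map f xs))) ≡ g (toSubset (take r (drop i xs)))
  window≈ i = begin
    toSubset (take r (drop i (map f xs)))  ≡⟨ cong (λ zs → toSubset (take r zs)) (drop-map i xs) ⟩
    toSubset (take r (map f (drop i xs)))  ≡⟨ cong toSubset (take-map r (drop i xs)) ⟩
    toSubset (map f (take r (drop i xs)))  ≡⟨ f≈g (take r (drop i xs)) ⟩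
    g (toSubset (take r (drop i xs)))      ∎
    where open ≡-Reasoning

record SingleVisit (r : ℕ) (x : Fin N) (xs : List (Fin N)) : Set where
  field
    before after : List (Fin N)
    split        : xs ≡ before ++ x ∷ after
    x∉before     : x ∉ₗ before
    x∉after      : x ∉ₗ after
    before≤      : length before ≤ r
    after≤       : length after ≤ r

visit-early : ∀ r {x : Fin N} A B → x ∉ₗ A → x ∈ₗ take (suc r) (A ++ x ∷ B) → length A ≤ r
visit-early r       []      B x∉A _           = z≤n
visit-early r       (a ∷ A) B x∉A (here refl) = ⊥-elim (x∉A (here refl))
visit-early (suc r) (a ∷ A) B x∉A (there x∈)  = s≤s (visit-early r A B (λ x∈A → x∉A (there x∈A)) x∈)

repeated-window : ∀ r (x y : Fin N) T → length T ≤ r → ∣ toSubset (x ∷ T) ∣ ≡ suc r →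
  x ∈ₗ T ++ [ y ] → toSubset (x ∷ T) ≡ toSubset (T ++ [ y ])
repeated-window r x y T T≤ size x∈ with ∈-++⁻ T x∈
... | inj₁ x∈T = ⊥-elim (<⇒≢ (<-≤-trans (repeated⇒small [] x T x∈T) (s≤s T≤)) size)
... | inj₂ (here refl) = begin
  ⁅ x ⁆ ∪ toSubset T         ≡⟨ cong (λ zs → ⁅ x ⁆ ∪ toSubset zs) (++-identityʳ T) ⟨
  ⁅ x ⁆ ∪ toSubset (T ++ []) ≡⟨ toSubset-insert T x [] ⟨
  toSubset (T ++ [ x ])      ∎
  where open ≡-Reasoning

module _ (r : ℕ) where

  private
    Sized : List (Subset N) → Set
    Sized = All (λ w → ∣ w ∣ ≡ suc r)

  -- after visiting x, the sequence ends within r steps: otherwise the window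
  -- starting at x and the next one (which must contain x again) coincide
  visit-late : ∀ (x : Fin N) B → Unique (windows (suc r) (x ∷ B)) → Sized (windows (suc r) (x ∷ B)) →
               All (x ∈_) (windows (suc r) (x ∷ B)) → length B ≤ r
  visit-late x B uniq sizes hits with suc r ≤? length B
  ... | no  short = ≤-pred (≰⇒> short)
  ... | yes long  = ⊥-elim (two-windows (windows-head (suc r) B) (take-suc-snoc r B long))
    where
    T = take r B
    two-windows : (Σ (List (Subset _)) λ rest → windows (suc r) B ≡ toSubset (take (suc r) B) ∷ rest) →
                  (Σ (Fin _) λ y → take (suc r) B ≡ T ++ [ y ]) → ⊥
    two-windows (rest , eq) (y , snoc) =
      Unique-head uniq′ (trans (repeated-window r x y T (length-take≤ r B) (All.head sizes′) x∈next)
                                       (cong toSubset (sym snoc)))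
      where
      ws : windows (suc r) (x ∷ B) ≡ toSubset (x ∷ T) ∷ toSubset (take (suc r) B) ∷ rest
      ws = trans (windows-cons (suc r) x B long) (cong (toSubset (x ∷ T) ∷_) eq)
      uniq′  = subst Unique ws uniq
      sizes′ = subst Sized ws sizes
      x∈next : x ∈ₗ T ++ [ y ]
      x∈next = subst (x ∈ₗ_) snoc (∈-toSubset⁻ _ (All.head (All.tail (subst (All (x ∈_)) ws hits))))

  single-visit : ∀ (x : Fin N) xs → suc r ≤ length xs → Unique (windows (suc r) xs) →
                 Sized (windows (suc r) xs) → All (x ∈_) (windows (suc r) xs) → SingleVisit r x xs
  single-visit x xs long uniq sizes hits with windows-head (suc r) xs
  ... | rest , eq with ∈-toSubset⁻ (take (suc r) xs) (All.head (subst (All (x ∈_)) eq hits))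
  ... | x∈first with split-first _≟_ xs (take-⊆ (suc r) x∈first)
  ... | A , B , refl , x∉A = record
    { before = A ; after = B ; split = refl ; x∉before = x∉A ; x∉after = x∉B
    ; before≤ = visit-early r A B x∉A x∈first ; after≤ = B≤ }
    where
    B≤ : length B ≤ r
    B≤ with r ≤? length B
    ... | no  short = <⇒≤ (≰⇒> short)
    ... | yes r≤B   with windows-suffix (suc r) A (x ∷ B) (s≤s r≤B)
    ...   | X , ws = visit-late x B (Unique-++⁻ʳ X (subst Unique ws uniq)) (All.++⁻ʳ X (subst Sized ws sizes))
                                    (All.++⁻ʳ X (subst (All (x ∈_)) ws hits))
    -- the last window contains the whole final segment x ∷ B
    x∉B : x ∉ₗ B
    x∉B x∈B with suffix-in-window (suc r) A (x ∷ B) (s≤s B≤) long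
    ... | T , ∈ws , len = <⇒≢ (repeated⇒small T x B (∈-++⁺ʳ T x∈B)) (trans (All.lookup sizes ∈ws) (sym len))

module _ {E : EdgeSet N} {E' : EdgeSet M} (g : Subset N → Subset M) (c r : ℕ)
         (g-size : ∀ w → ∣ g w ∣ ≡ c + ∣ w ∣)
         {xs ys} (ws : windows (c + r) xs ≡ map g (windows r ys)) where

  WindowsOK-pull : (∀ w → E' (g w) → E w) → r ≤ length ys →
    Unique (windows (c + r) xs) → All (λ w → ∣ w ∣ ≡ c + r) (windows (c + r) xs) →
    All E' (windows (c + r) xs) → WindowsOK r E ys
  WindowsOK-pull pull r≤ uniq sizes edges =
    r≤ , Unique.map⁻ (subst Unique ws uniq) ,
    All.map (λ {w} size → +-cancelˡ-≡ c _ _ (trans (sym (g-size w)) size)) (All.map⁻ (subst Sized ws sizes)) ,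
    All.map (λ {w} → pull w) (All.map⁻ (subst (All E') ws edges))
    where Sized = All (λ w → ∣ w ∣ ≡ c + r)

  WindowsOK-push : (∀ {w w'} → g w ≡ g w' → w ≡ w') → (∀ w → E w → E' (g w)) → c + r ≤ length xs →
    WindowsOK r E ys → WindowsOK (c + r) E' xs
  WindowsOK-push g-inj push len (_ , uniq , sizes , edges) =
    len , subst Unique (sym ws) (Unique.map⁺ g-inj uniq) ,
    subst (All (λ w → ∣ w ∣ ≡ c + r)) (sym ws)
      (All.map⁺ (All.map (λ {w} size → trans (g-size w) (cong (c +_) size)) sizes)) ,
    subst (All E') (sym ws) (All.map⁺ (All.map (λ {w} → push w) edges))

edge-chain : ∀ r {E : EdgeSet N} {W} → E W → ∣ W ∣ ≡ r → ∀ {x y} → x ∈ W → y ∈ W → x ≢ y →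
  Σ (List (Fin N)) λ vs → ChainIn r E vs × x ∈ₗ vs × y ∈ₗ vs
edge-chain r {E} {W} EW size {x} {y} x∈W y∈W x≢y =
  vs , ((x , y , mid , refl , x≢y) , windowsOK) , here refl , there (∈-++⁺ʳ mid (here refl))
  where
  mid = elements (W - x - y)
  vs  = x ∷ mid ++ [ y ]
  y∈W-x : y ∈ W - x
  y∈W-x = x∈p∧x≢y⇒x∈p-y y∈W (λ y≡x → x≢y (sym y≡x))
  length-vs : length vs ≡ r
  length-vs = begin
    suc (length (mid ++ [ y ]))  ≡⟨ cong suc (length-++ mid) ⟩
    suc (length mid + 1)         ≡⟨ cong suc (+-comm (length mid) 1) ⟩
    suc (suc (length mid))       ≡⟨ cong (λ m → suc (suc m)) (length-elements (W - x - y)) ⟩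
    suc (suc ∣ W - x - y ∣)      ≡⟨ cong suc (∣p-x∣ (W - x) y y∈W-x) ⟩
    suc ∣ W - x ∣                ≡⟨ ∣p-x∣ W x x∈W ⟩
    ∣ W ∣                        ≡⟨ size ⟩
    r                            ∎
    where open ≡-Reasoning
  vs⊆W : toSubset vs ⊆ W
  vs⊆W z∈ with ∈-toSubset⁻ vs z∈
  ... | here refl = x∈W
  ... | there z∈′ with ∈-++⁻ mid z∈′
  ...   | inj₁ z∈M        = p─q⊆p W _ (p─q⊆p (W - x) _ (∈-elements⁻ _ z∈M))
  ...   | inj₂ (here refl) = y∈W
  W⊆vs : W ⊆ toSubset vs
  W⊆vs {z} z∈ with z ≟ x | z ≟ y
  ... | yes refl | _        = ∈-toSubset⁺ {xs = vs} (here refl)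
  ... | no  _    | yes refl = ∈-toSubset⁺ {xs = vs} (there (∈-++⁺ʳ mid (here refl)))
  ... | no  z≢x  | no  z≢y  =
    ∈-toSubset⁺ {xs = vs} (there (∈-++⁺ˡ (∈-elements⁺ (x∈p∧x≢y⇒x∈p-y (x∈p∧x≢y⇒x∈p-y z∈ z≢x) z≢y))))
  one-window : windows r vs ≡ [ W ]
  one-window = trans (windows-short r vs (≤-reflexive length-vs)) (cong [_] (⊆-antisym vs⊆W W⊆vs))
  windowsOK : WindowsOK r E vs
  windowsOK rewrite one-window = ≤-reflexive (sym length-vs) , [] ∷ [] , size ∷ [] , EW ∷ []

-- A cyclic sequence repeats its first window at the end,
-- so there is no "sequence" semicycle with windows of length 1; and two distinct
-- singleton edges {a}, {b} form the chain a, b.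
no-1-semicycle : ∀ {E : EdgeSet N} t → ¬ SeqSemicycle 1 E t
no-1-semicycle t (_ , (a , mid , refl) , (_ , uniq , _) , _)
  with windows-suffix 1 mid [ a ] (s≤s z≤n)
... | X , ws = last≢first (subst Unique windows≡ uniq)
  where
  w = toSubset [ a ]
  windows≡ : windows 1 (a ∷ mid ++ [ a ]) ≡ w ∷ X ++ [ w ]
  windows≡ = trans (windows-cons 1 a (mid ++ [ a ]) (subst (1 ≤_) (sym (length-++-sucʳ mid a [])) (s≤s z≤n)))
                   (cong (w ∷_) ws)
  last≢first : ¬ Unique (w ∷ X ++ [ w ])
  last≢first (w≢ ∷ _) = All.head (All.++⁻ʳ X w≢) refl

pair-windowsOK : ∀ {E : EdgeSet N} {a b} → a ≢ b → E ⁅ a ⁆ → E ⁅ b ⁆ → WindowsOK 1 E (a ∷ b ∷ [])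
pair-windowsOK {E = E} {a} {b} a≢b Ea Eb =
  s≤s z≤n ,
  ((λ eq → a≢b (x∈⁅y⁆⇒x≡y b (subst (a ∈_) (trans (sym (∪-identityʳ ⁅ a ⁆)) (trans eq (∪-identityʳ ⁅ b ⁆))) (x∈⁅x⁆ a)))) ∷ [])
    ∷ [] ∷ [] ,
  size a ∷ size b ∷ [] ,
  subst E (sym (∪-identityʳ ⁅ a ⁆)) Ea ∷ subst E (sym (∪-identityʳ ⁅ b ⁆)) Eb ∷ []
  where
  size : ∀ x → ∣ toSubset [ x ] ∣ ≡ 1
  size x = trans (cong ∣_∣ (∪-identityʳ ⁅ x ⁆)) (∣⁅x⁆∣≡1 x)

module _ {n l : ℕ} where

  vertex-view : (z : Fin (n + l)) → (Σ (Fin n) λ a → z ≡ a ↑ˡ l) ⊎ (Σ (Fin l) λ i → z ≡ n ↑ʳ i)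
  vertex-view z with splitAt n z in eq
  ... | inj₁ a = inj₁ (a , sym (splitAt⁻¹-↑ˡ eq))
  ... | inj₂ i = inj₂ (i , sym (splitAt⁻¹-↑ʳ eq))

  ↑ˡ≢↑ʳ : ∀ {a : Fin n} {i : Fin l} → a ↑ˡ l ≢ n ↑ʳ i
  ↑ˡ≢↑ʳ {a} {i} eq with trans (sym (splitAt-↑ˡ n a l)) (trans (cong (splitAt n) eq) (splitAt-↑ʳ n l i))
  ... | ()

  ∈-↑ˡ⁺ : ∀ {p : Subset n} {q : Subset l} {a} → a ∈ p → a ↑ˡ l ∈ p ++ᵥ q
  ∈-↑ˡ⁺ {p} {q} {a} a∈ = lookup⇒[]= (a ↑ˡ l) (p ++ᵥ q) (trans (lookup-++ˡ p q a) ([]=⇒lookup a∈))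

  ∈-↑ˡ⁻ : ∀ {p : Subset n} {q : Subset l} {a} → a ↑ˡ l ∈ p ++ᵥ q → a ∈ p
  ∈-↑ˡ⁻ {p} {q} {a} a∈ = lookup⇒[]= a p (trans (sym (lookup-++ˡ p q a)) ([]=⇒lookup a∈))

  ∈-↑ʳ⁺ : ∀ {p : Subset n} {q : Subset l} {i} → i ∈ q → n ↑ʳ i ∈ p ++ᵥ q
  ∈-↑ʳ⁺ {p} {q} {i} i∈ = lookup⇒[]= (n ↑ʳ i) (p ++ᵥ q) (trans (lookup-++ʳ p q i) ([]=⇒lookup i∈))

  ∈-↑ʳ⁻ : ∀ {p : Subset n} {q : Subset l} {i} → n ↑ʳ i ∈ p ++ᵥ q → i ∈ q
  ∈-↑ʳ⁻ {p} {q} {i} i∈ = lookup⇒[]= i q (trans (sym (lookup-++ʳ p q i)) ([]=⇒lookup i∈))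

∣++∣ : ∀ (p : Subset n) (q : Subset l) → ∣ p ++ᵥ q ∣ ≡ ∣ p ∣ + ∣ q ∣
∣++∣ []          q = refl
∣++∣ (true ∷ p)  q = cong suc (∣++∣ p q)
∣++∣ (false ∷ p) q = ∣++∣ p q

∣p++⁅i⁆∣ : ∀ (p : Subset n) (i : Fin l) → ∣ p ++ᵥ ⁅ i ⁆ ∣ ≡ 1 + ∣ p ∣
∣p++⁅i⁆∣ p i = trans (∣++∣ p ⁅ i ⁆) (trans (cong (∣ p ∣ +_) (∣⁅x⁆∣≡1 i)) (+-comm ∣ p ∣ 1))

∣∅++p∣ : ∀ n (p : Subset l) → ∣ ∅ {n} ++ᵥ p ∣ ≡ 0 + ∣ p ∣
∣∅++p∣ n p = trans (∣++∣ (∅ {n}) p) (cong (_+ ∣ p ∣) (∣⊥∣≡0 n))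

∅++∅ : ∀ n l → ∅ {n} ++ᵥ ∅ {l} ≡ ∅
∅++∅ zero    l = refl
∅++∅ (suc n) l = cong (false ∷_) (∅++∅ n l)

⁅↑ˡ⁆ : ∀ (a : Fin n) → ⁅ a ↑ˡ l ⁆ ≡ ⁅ a ⁆ ++ᵥ ∅
⁅↑ˡ⁆ {n = suc n} {l} zero = cong (true ∷_) (sym (∅++∅ n l))
⁅↑ˡ⁆ (suc a) = cong (false ∷_) (⁅↑ˡ⁆ a)

⁅↑ʳ⁆ : ∀ n (i : Fin l) → ⁅ n ↑ʳ i ⁆ ≡ ∅ ++ᵥ ⁅ i ⁆
⁅↑ʳ⁆ zero    i = refl
⁅↑ʳ⁆ (suc n) i = cong (false ∷_) (⁅↑ʳ⁆ n i)

∪-++ : ∀ (p p′ : Subset n) (q q′ : Subset l) → (p ++ᵥ q) ∪ (p′ ++ᵥ q′) ≡ (p ∪ p′) ++ᵥ (q ∪ q′)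
∪-++ p p′ q q′ = zipWith-++ _∨_ p q p′ q′

∩-++ : ∀ (p p′ : Subset n) (q q′ : Subset l) → (p ++ᵥ q) ∩ (p′ ++ᵥ q′) ≡ (p ∩ p′) ++ᵥ (q ∩ q′)
∩-++ p p′ q q′ = zipWith-++ _∧_ p q p′ q′

toSubset-↑ˡ : ∀ (ys : List (Fin n)) → toSubset (map (_↑ˡ l) ys) ≡ toSubset ys ++ᵥ ∅
toSubset-↑ˡ {n} {l} [] = sym (∅++∅ n l)
toSubset-↑ˡ {l = l} (y ∷ ys) = begin
  ⁅ y ↑ˡ l ⁆ ∪ toSubset (map (_↑ˡ l) ys)   ≡⟨ cong₂ _∪_ (⁅↑ˡ⁆ y) (toSubset-↑ˡ ys) ⟩
  (⁅ y ⁆ ++ᵥ ∅) ∪ (toSubset ys ++ᵥ ∅)      ≡⟨ ∪-++ ⁅ y ⁆ (toSubset ys) (∅ {l}) ∅ ⟩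
  (⁅ y ⁆ ∪ toSubset ys) ++ᵥ (∅ ∪ ∅)        ≡⟨ cong (_ ++ᵥ_) (∪-identityˡ (∅ {l})) ⟩
  (⁅ y ⁆ ∪ toSubset ys) ++ᵥ ∅              ∎
  where open ≡-Reasoning

toSubset-↑ʳ : ∀ n (ys : List (Fin l)) → toSubset (map (n ↑ʳ_) ys) ≡ ∅ ++ᵥ toSubset ys
toSubset-↑ʳ {l} n [] = sym (∅++∅ n l)
toSubset-↑ʳ n (y ∷ ys) = begin
  ⁅ n ↑ʳ y ⁆ ∪ toSubset (map (n ↑ʳ_) ys)   ≡⟨ cong₂ _∪_ (⁅↑ʳ⁆ n y) (toSubset-↑ʳ n ys) ⟩
  (∅ ++ᵥ ⁅ y ⁆) ∪ (∅ ++ᵥ toSubset ys)      ≡⟨ ∪-++ (∅ {n}) ∅ ⁅ y ⁆ (toSubset ys) ⟩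
  (∅ ∪ ∅) ++ᵥ (⁅ y ⁆ ∪ toSubset ys)        ≡⟨ cong (_++ᵥ _) (∪-identityˡ (∅ {n})) ⟩
  ∅ ++ᵥ (⁅ y ⁆ ∪ toSubset ys)              ∎
  where open ≡-Reasoning

add-↑ʳ : ∀ (w : Subset n) (i : Fin l) → ⁅ n ↑ʳ i ⁆ ∪ (w ++ᵥ ∅) ≡ w ++ᵥ ⁅ i ⁆
add-↑ʳ {n} {l} w i = begin
  ⁅ n ↑ʳ i ⁆ ∪ (w ++ᵥ ∅)      ≡⟨ cong (_∪ (w ++ᵥ ∅)) (⁅↑ʳ⁆ n i) ⟩
  (∅ ++ᵥ ⁅ i ⁆) ∪ (w ++ᵥ ∅)   ≡⟨ ∪-++ ∅ w ⁅ i ⁆ (∅ {l}) ⟩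
  (∅ ∪ w) ++ᵥ (⁅ i ⁆ ∪ ∅)     ≡⟨ cong₂ _++ᵥ_ (∪-identityˡ w) (∪-identityʳ ⁅ i ⁆) ⟩
  w ++ᵥ ⁅ i ⁆                 ∎
  where open ≡-Reasoning

windows-insert-↑ʳ : ∀ r A B (i : Fin l) (ts : List (Fin n)) → length A ≤ r → length B ≤ r →
  A ++ B ≡ map (_↑ˡ l) ts → windows (suc r) (A ++ (n ↑ʳ i) ∷ B) ≡ map (_++ᵥ ⁅ i ⁆) (windows r ts)
windows-insert-↑ʳ {l} {n} r A B i ts A≤ B≤ A++B≡ = begin
  windows (suc r) (A ++ q ∷ B)                  ≡⟨ windows-insert r A q B A≤ B≤ ⟩
  map (⁅ q ⁆ ∪_) (windows r (A ++ B))           ≡⟨ cong (λ xs → map (⁅ q ⁆ ∪_) (windows r xs)) A++B≡ ⟩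
  map (⁅ q ⁆ ∪_) (windows r (map (_↑ˡ l) ts))   ≡⟨ cong (map (⁅ q ⁆ ∪_)) (windows-map (_↑ˡ l) (_++ᵥ ∅) toSubset-↑ˡ r ts) ⟩
  map (⁅ q ⁆ ∪_) (map (_++ᵥ ∅) (windows r ts))  ≡⟨ map-∘ (windows r ts) ⟨
  map (λ w → ⁅ q ⁆ ∪ (w ++ᵥ ∅)) (windows r ts)  ≡⟨ map-cong (λ w → add-↑ʳ w i) (windows r ts) ⟩
  map (_++ᵥ ⁅ i ⁆) (windows r ts)               ∎
  where
  open ≡-Reasoning
  q = n ↑ʳ i

-- Besides the hypotheses of
-- the theorem on Q and F we assume that an edge of F never shares k - 1 vertices
-- with an edge e ∪ {q_i} (because k ≥ 3, or because F has no edges) and that any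
-- two base vertices lie on a common chain; the theorem provides both below.
module Construction
  {k₂ n l : ℕ} (Q : Fin l → Subset n → Set) (D : Subset l → Set)
  (Q-size     : ∀ i e → Q i e → ∣ e ∣ ≡ suc k₂)
  (Q-disjoint : ∀ i j e → Q i e → Q j e → i ≡ j)
  (Q-covers   : ∀ i → Covers (Q i))
  (Q-acyclic  : ∀ i t → t ≤ suc (suc k₂) → ¬ SeqSemicycle (suc k₂) (Q i) t)
  (F-tree     : IsHypertree (suc (suc k₂)) D)
  (separated  : (∀ d → ¬ D d) ⊎ 2 ≤ suc k₂)
  (base-chain : ∀ a b → a ≢ b → Σ (List (Fin (n + l))) λ vs →
                ChainIn (suc (suc k₂)) (HEdges Q D) vs × a ↑ˡ l ∈ₗ vs × b ↑ˡ l ∈ₗ vs)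
  where

  k₁ k : ℕ
  k₁ = suc k₂
  k  = suc k₁

  H : EdgeSet (n + l)
  H = HEdges Q D

  QEdge : Fin l → Subset (n + l) → Set
  QEdge i W = Σ (Subset n) λ e → Q i e × W ≡ e ++ᵥ ⁅ i ⁆

  FEdge : Subset (n + l) → Set
  FEdge W = Σ (Subset l) λ d → D d × W ≡ ∅ ++ᵥ d

  uniform : Uniform k H
  uniform _ (inj₁ (i , e , qe , refl)) = trans (∣p++⁅i⁆∣ e i) (cong suc (Q-size i e qe))
  uniform _ (inj₂ (d , dd , refl))     = trans (∣∅++p∣ n d) (proj₁ F-tree d dd)

  -- two edges e ∪ {q_i}, e′ ∪ {q_j} sharing k - 1 vertices have e = e′, hence i = j
  Q-overlap : ∀ {i j e e′} → Q i e → Q j e′ → k₁ ≤ ∣ (e ++ᵥ ⁅ i ⁆) ∩ (e′ ++ᵥ ⁅ j ⁆) ∣ → i ≡ j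
  Q-overlap {i} {j} {e} {e′} qe qe′ big with i ≟ j
  ... | yes i≡j = i≡j
  ... | no  i≢j = Q-disjoint i j e qe (subst (Q j) (sym e≡e′) qe′)
    where
    big′ : k₁ ≤ ∣ e ∩ e′ ∣
    big′ = begin
      k₁                                  ≤⟨ big ⟩
      ∣ (e ++ᵥ ⁅ i ⁆) ∩ (e′ ++ᵥ ⁅ j ⁆) ∣  ≡⟨ cong ∣_∣ (∩-++ e e′ ⁅ i ⁆ ⁅ j ⁆) ⟩
      ∣ (e ∩ e′) ++ᵥ (⁅ i ⁆ ∩ ⁅ j ⁆) ∣    ≡⟨ cong (λ p → ∣ (e ∩ e′) ++ᵥ p ∣) (⁅x⁆∩⁅y⁆≡∅ i≢j) ⟩
      ∣ (e ∩ e′) ++ᵥ ∅ ∣                  ≡⟨ ∣++∣ (e ∩ e′) ∅ ⟩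
      ∣ e ∩ e′ ∣ + ∣ ∅ {l} ∣              ≡⟨ cong (∣ e ∩ e′ ∣ +_) (∣⊥∣≡0 l) ⟩
      ∣ e ∩ e′ ∣ + 0                      ≡⟨ +-identityʳ _ ⟩
      ∣ e ∩ e′ ∣                          ∎
      where open ≤-Reasoning
    e≡e′ : e ≡ e′
    e≡e′ = trans (sym (⊆-size-antisym (p∩q⊆p e e′) (≤-trans (≤-reflexive (Q-size i e qe)) big′)))
                 (⊆-size-antisym (p∩q⊆q e e′) (≤-trans (≤-reflexive (Q-size j e′ qe′)) big′))

  FQ-overlap : ∀ {d e j} → D d → Q j e → ∣ (∅ ++ᵥ d) ∩ (e ++ᵥ ⁅ j ⁆) ∣ < k₁
  FQ-overlap {d} {e} {j} dd qe = bound separated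
    where
    bound : (∀ d → ¬ D d) ⊎ 2 ≤ k₁ → ∣ (∅ ++ᵥ d) ∩ (e ++ᵥ ⁅ j ⁆) ∣ < k₁
    bound (inj₁ no-edges) = ⊥-elim (no-edges d dd)
    bound (inj₂ 2≤k₁)     = begin-strict
      ∣ (∅ ++ᵥ d) ∩ (e ++ᵥ ⁅ j ⁆) ∣  ≡⟨ cong ∣_∣ (∩-++ ∅ e d ⁅ j ⁆) ⟩
      ∣ (∅ ∩ e) ++ᵥ (d ∩ ⁅ j ⁆) ∣    ≡⟨ cong (λ p → ∣ p ++ᵥ (d ∩ ⁅ j ⁆) ∣) (∩-zeroˡ e) ⟩
      ∣ ∅ {n} ++ᵥ (d ∩ ⁅ j ⁆) ∣      ≡⟨ ∣∅++p∣ n (d ∩ ⁅ j ⁆) ⟩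
      ∣ d ∩ ⁅ j ⁆ ∣                  ≤⟨ ∣p∩q∣≤∣q∣ d ⁅ j ⁆ ⟩
      ∣ ⁅ j ⁆ ∣                      ≡⟨ ∣⁅x⁆∣≡1 j ⟩
      1                              <⟨ 2≤k₁ ⟩
      k₁                             ∎
      where open ≤-Reasoning

  F-propagates : ∀ {W W′} → H W′ → k₁ ≤ ∣ W ∩ W′ ∣ → FEdge W → FEdge W′
  F-propagates (inj₂ fW′)                  _   _                = fW′
  F-propagates (inj₁ (j , e , qe , refl)) big (d , dd , refl) = ⊥-elim (<⇒≱ (FQ-overlap dd qe) big)

  Q-propagates : ∀ {i W W′} → H W′ → k₁ ≤ ∣ W ∩ W′ ∣ → QEdge i W → QEdge i W′
  Q-propagates (inj₁ (j , e′ , qe′ , refl)) big (e , qe , refl) rewrite Q-overlap qe qe′ big = e′ , qe′ , refl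
  Q-propagates {i} (inj₂ (d , dd , refl)) big (e , qe , refl) =
    ⊥-elim (<⇒≱ (FQ-overlap dd qe) (subst (k₁ ≤_) (cong ∣_∣ (∩-comm (e ++ᵥ ⁅ i ⁆) (∅ ++ᵥ d))) big))

  one-kind : ∀ vs → All (λ w → ∣ w ∣ ≡ k) (windows k vs) → All H (windows k vs) →
             All FEdge (windows k vs) ⊎ Σ (Fin l) λ i → All (QEdge i) (windows k vs)
  one-kind vs sizes edges with windows-head k vs
  ... | rest , eq with subst (All H) eq edges | subst (Linked _) eq (windows-linked k₁ vs sizes)
  ... | inj₂ fW ∷ edges′ | links =
    inj₁ (subst (All FEdge) (sym eq) (Linked-propagate (λ _ hW′ → F-propagates hW′) links (inj₂ fW ∷ edges′) fW))
  ... | inj₁ (i , qW) ∷ edges′ | links =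
    inj₂ (i , subst (All (QEdge i)) (sym eq) (Linked-propagate (λ _ hW′ → Q-propagates hW′) links (inj₁ (i , qW) ∷ edges′) qW))

  F-vertices : ∀ vs → All FEdge (windows k vs) → ∀ {z} → z ∈ₗ vs → Σ (Fin l) λ b → z ≡ n ↑ʳ b
  F-vertices vs fedges {z} z∈ with window-containing k₁ vs fedges z∈
  ... | _ , (d , _ , refl) , z∈W with vertex-view {n} {l} z
  ...   | inj₁ (a , refl) = ⊥-elim (∉⊥ (∈-↑ˡ⁻ z∈W))
  ...   | inj₂ (b , z≡)   = b , z≡

  Q-vertices : ∀ i vs → All (QEdge i) (windows k vs) → ∀ {z} → z ∈ₗ vs → z ≢ n ↑ʳ i →
               Σ (Fin n) λ a → z ≡ a ↑ˡ l
  Q-vertices i vs qedges {z} z∈ z≢q with window-containing k₁ vs qedges z∈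
  ... | _ , (e , _ , refl) , z∈W with vertex-view {n} {l} z
  ...   | inj₁ (a , z≡)   = a , z≡
  ...   | inj₂ (j , refl) = ⊥-elim (z≢q (cong (n ↑ʳ_) (x∈⁅y⁆⇒x≡y i (∈-↑ʳ⁻ z∈W))))

  F-semicycle : ∀ t vs → Cyclic vs → WindowsOK k H vs → t ≡ suc (length vs ∸ k) →
                All FEdge (windows k vs) → SeqSemicycle k D t
  F-semicycle t vs cyc (k≤ , uniq , sizes , _) t≡ fedges with unmap (n ↑ʳ_) vs (F-vertices vs fedges)
  ... | us , refl =
    us , Cyclic-unmap (n ↑ʳ_) (↑ʳ-injective n _ _) us cyc ,
    WindowsOK-pull (∅ ++ᵥ_) 0 k (∣∅++p∣ n) ws pull (subst (k ≤_) (length-map _ us) k≤) uniq sizes fedges ,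
    trans t≡ (cong (λ m → suc (m ∸ k)) (length-map _ us))
    where
    ws = windows-map (n ↑ʳ_) (∅ ++ᵥ_) (toSubset-↑ʳ n) k us
    pull : ∀ w → FEdge (∅ ++ᵥ w) → D w
    pull w (d , dd , eq) = subst D (sym (++-injectiveʳ ∅ ∅ eq)) dd

  -- A semicycle of H through edges e ∪ {q_i} of one class has q_i in every window,
  -- so it is A ++ q_i ∷ B with A, B short and free of q_i (single-visit); A ++ B
  -- consists of base vertices ts, and ts is a semicycle of Q^i of length at most k.
  Q-semicycle : ∀ i t vs → Cyclic vs → WindowsOK k H vs → t ≡ suc (length vs ∸ k) →
                All (QEdge i) (windows k vs) → t ≤ k × SeqSemicycle k₁ (Q i) t
  Q-semicycle i t vs cyc (k≤ , uniq , sizes , _) t≡ qedges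
    with single-visit k₁ (n ↑ʳ i) vs k≤ uniq sizes (All.map (λ { (e , _ , refl) → ∈-↑ʳ⁺ (x∈⁅x⁆ i) }) qedges)
  ... | record { before = A ; after = B ; split = refl ; x∉before = q∉A ; x∉after = q∉B
               ; before≤ = A≤ ; after≤ = B≤ }
    with unmap (_↑ˡ l) (A ++ B)
           (λ z∈ → Q-vertices i _ qedges (∈-insert A z∈) (λ { refl → ∉-++ A q∉A q∉B z∈ }))
  ... | ts , A++B≡ = t≤k , ts , cyc-ts , wok , t≡′
    where
    length≡ : length (A ++ (n ↑ʳ i) ∷ B) ≡ suc (length ts)
    length≡ = trans (length-++-sucʳ A _ B) (cong suc (trans (cong length A++B≡) (length-map _ ts)))
    wok : WindowsOK k₁ (Q i) ts
    wok = WindowsOK-pull (_++ᵥ ⁅ i ⁆) 1 k₁ (λ w → ∣p++⁅i⁆∣ w i)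
            (windows-insert-↑ʳ k₁ A B i ts A≤ B≤ A++B≡)
            (λ w → λ { (e , qe , eq) → subst (Q i) (sym (++-injectiveˡ w e eq)) qe })
            (≤-pred (subst (k ≤_) length≡ k≤)) uniq sizes qedges
    cyc-ts : Cyclic ts
    cyc-ts = Cyclic-unmap (_↑ˡ l) (↑ˡ-injective l _ _) ts (subst Cyclic A++B≡ (Cyclic-remove A B cyc q∉A q∉B))
    t≡′ : t ≡ suc (length ts ∸ k₁)
    t≡′ = trans t≡ (cong (λ m → suc (m ∸ k)) length≡)
    t≤k : t ≤ k
    t≤k = subst (_≤ k) (sym t≡′) (s≤s (m≤n+o⇒m∸n≤o (length ts) k₁ (begin
      length ts              ≡⟨ length-map (_↑ˡ l) ts ⟨
      length (map _ ts)      ≡⟨ cong length A++B≡ ⟨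
      length (A ++ B)        ≡⟨ length-++ A ⟩
      length A + length B    ≤⟨ +-mono-≤ A≤ B≤ ⟩
      k₁ + k₁                ∎)))
      where open ≤-Reasoning

  semicycle-free : SemicycleFree k H
  semicycle-free t (vs , cyc , wok@(_ , _ , sizes , edges) , t≡) with one-kind vs sizes edges
  ... | inj₁ fedges       = proj₂ (proj₂ F-tree) t (F-semicycle t vs cyc wok t≡ fedges)
  ... | inj₂ (i , qedges) = let (t≤k , semicycle) = Q-semicycle i t vs cyc wok t≡ qedges
                            in Q-acyclic i t t≤k semicycle

  base-hub-chain : ∀ a j → Σ (List (Fin (n + l))) λ vs → ChainIn k H vs × a ↑ˡ l ∈ₗ vs × n ↑ʳ j ∈ₗ vs
  base-hub-chain a j with Q-covers j a
  ... | e , qe , a∈e = edge-chain k edge (uniform _ edge) (∈-↑ˡ⁺ a∈e) (∈-↑ʳ⁺ (x∈⁅x⁆ j)) ↑ˡ≢↑ʳ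
    where edge = inj₁ (j , e , qe , refl)

  hub-chain : ∀ i j → i ≢ j → Σ (List (Fin (n + l))) λ vs → ChainIn k H vs × n ↑ʳ i ∈ₗ vs × n ↑ʳ j ∈ₗ vs
  hub-chain i j i≢j with proj₁ (proj₂ F-tree) i j i≢j
  ... | us , ((a , b , mid , refl , a≢b) , wok) , i∈ , j∈ =
    map (n ↑ʳ_) (a ∷ mid ++ [ b ]) ,
    ((n ↑ʳ a , n ↑ʳ b , map (n ↑ʳ_) mid , cong ((n ↑ʳ a) ∷_) (map-++ (n ↑ʳ_) mid [ b ]) ,
      λ qa≡qb → a≢b (↑ʳ-injective n a b qa≡qb)) ,
     WindowsOK-push (∅ ++ᵥ_) 0 k (∣∅++p∣ n) (windows-map (n ↑ʳ_) (∅ ++ᵥ_) (toSubset-↑ʳ n) k (a ∷ mid ++ [ b ]))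
       (++-injectiveʳ ∅ ∅) (λ w dw → inj₂ (w , dw , refl))
       (subst (k ≤_) (sym (length-map _ (a ∷ mid ++ [ b ]))) (proj₁ wok)) wok) ,
    ∈-map⁺ (n ↑ʳ_) i∈ , ∈-map⁺ (n ↑ʳ_) j∈

  connected : ChainConnected k H
  connected x y x≢y with vertex-view {n} {l} x | vertex-view {n} {l} y
  ... | inj₁ (a , refl) | inj₁ (b , refl) = base-chain a b (λ a≡b → x≢y (cong (_↑ˡ l) a≡b))
  ... | inj₁ (a , refl) | inj₂ (j , refl) = base-hub-chain a j
  ... | inj₂ (i , refl) | inj₁ (b , refl) = let (vs , chain , b∈ , i∈) = base-hub-chain b i in vs , chain , i∈ , b∈
  ... | inj₂ (i , refl) | inj₂ (j , refl) = hub-chain i j (λ i≡j → x≢y (cong (n ↑ʳ_) i≡j))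

  hypertree : IsHypertree k H
  hypertree = uniform , connected , semicycle-free

-- The case k = 2.  Every class Q^i covers [n] by singletons, so it contains all
-- singletons; hence there is at most one class, F (being 2-uniform on at most one
-- vertex) has no edges, and base vertices a ≠ b lie on the chain a, q_i, b.
module GraphCase {n l : ℕ} (Q : Fin l → Subset n → Set) (1≤n : 1 ≤ n)
  (Q-size      : ∀ i e → Q i e → ∣ e ∣ ≡ 1)
  (Q-partition : ∀ e → ∣ e ∣ ≡ 1 → Σ (Fin l) λ i → Q i e)
  (Q-disjoint  : ∀ i j e → Q i e → Q j e → i ≡ j)
  (Q-covers    : ∀ i → Covers (Q i))
  where

  singletons : ∀ i x → Q i ⁅ x ⁆
  singletons i x with Q-covers i x
  ... | e , qe , x∈e = subst (Q i) (sym (⊆-size-antisym ⁅x⁆⊆e (≤-reflexive (trans (Q-size i e qe) (sym (∣⁅x⁆∣≡1 x)))))) qe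
    where
    ⁅x⁆⊆e : ⁅ x ⁆ ⊆ e
    ⁅x⁆⊆e y∈ = subst (_∈ e) (sym (x∈⁅y⁆⇒x≡y x y∈)) x∈e

  -- any two classes share the singleton {x₀} of some base vertex x₀
  at-most-one-class : l ≤ 1
  at-most-one-class = all-equal (λ i j → Q-disjoint i j ⁅ x₀ ⁆ (singletons i x₀) (singletons j x₀))
    where
    x₀ = fromℕ< {0} {n} 1≤n
    all-equal : ∀ {m} → (∀ (i j : Fin m) → i ≡ j) → m ≤ 1
    all-equal {zero}        _   = z≤n
    all-equal {suc zero}    _   = s≤s z≤n
    all-equal {suc (suc m)} eq with eq zero (suc zero)
    ... | ()

  no-F-edges : ∀ {D : Subset l → Set} → Uniform 2 D → ∀ d → ¬ D d
  no-F-edges D-uniform d dd =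
    <⇒≱ (s≤s (s≤s z≤n)) (≤-trans (≤-reflexive (sym (D-uniform d dd))) (≤-trans (∣p∣≤n d) at-most-one-class))

  base-chain : ∀ (D : Subset l → Set) a b → a ≢ b → Σ (List (Fin (n + l))) λ vs →
               ChainIn 2 (HEdges Q D) vs × a ↑ˡ l ∈ₗ vs × b ↑ˡ l ∈ₗ vs
  base-chain D a b a≢b with Q-partition ⁅ a ⁆ (∣⁅x⁆∣≡1 a)
  ... | i , _ = vs , ((a ↑ˡ l , b ↑ˡ l , [ n ↑ʳ i ] , refl , λ eq → a≢b (↑ˡ-injective l a b eq)) , windowsOK) ,
                here refl , there (there (here refl))
    where
    vs = (a ↑ˡ l) ∷ (n ↑ʳ i) ∷ (b ↑ˡ l) ∷ []
    windowsOK : WindowsOK 2 (HEdges Q D) vs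
    windowsOK = WindowsOK-push (_++ᵥ ⁅ i ⁆) 1 1 (λ w → ∣p++⁅i⁆∣ w i) {vs} {a ∷ b ∷ []}
      (windows-insert-↑ʳ 1 [ a ↑ˡ l ] [ b ↑ˡ l ] i (a ∷ b ∷ []) ≤-refl ≤-refl refl)
      (++-injectiveˡ _ _) (λ w qw → inj₁ (i , w , qw , refl)) (s≤s (s≤s z≤n))
      (pair-windowsOK a≢b (singletons i a) (singletons i b))

-- The case k ≥ 3: two base vertices a ≠ b lie in a common (k - 1)-subset e of
-- [n] (as k - 1 ≤ n), which belongs to some class Q^i; so both lie on e ∪ {q_i}.
base-chain-large : ∀ {k₃ n l} (Q : Fin l → Subset n → Set) (D : Subset l → Set) →
  suc (suc k₃) ≤ n → (∀ e → ∣ e ∣ ≡ suc (suc k₃) → Σ (Fin l) λ i → Q i e) →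
  ∀ a b → a ≢ b → Σ (List (Fin (n + l))) λ vs →
  ChainIn (suc (suc (suc k₃))) (HEdges Q D) vs × a ↑ˡ l ∈ₗ vs × b ↑ˡ l ∈ₗ vs
base-chain-large {k₃} {n} {l} Q D k₁≤n Q-partition a b a≢b with extend (⁅ a ⁆ ∪ ⁅ b ⁆) (suc (suc k₃)) pair≤ k₁≤n
  where
  pair≤ : ∣ ⁅ a ⁆ ∪ ⁅ b ⁆ ∣ ≤ suc (suc k₃)
  pair≤ = ≤-trans (∣⁅x⁆∪p∣≤ a ⁅ b ⁆) (s≤s (≤-trans (≤-reflexive (∣⁅x⁆∣≡1 b)) (s≤s z≤n)))
... | e , ab⊆e , size with Q-partition e size
... | i , qe = edge-chain _ (inj₁ (i , e , qe , refl)) (trans (∣p++⁅i⁆∣ e i) (cong suc size))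
                 (∈-↑ˡ⁺ (ab⊆e (x∈p∪q⁺ (inj₁ (x∈⁅x⁆ a))))) (∈-↑ˡ⁺ (ab⊆e (x∈p∪q⁺ (inj₂ (x∈⁅x⁆ b)))))
                 (λ eq → a≢b (↑ˡ-injective l a b eq))

-- The theorem: the construction, with its side conditions supplied by the case
-- k = 2 (F has no edges; semicycles of Q^i would have windows of length 1) or k ≥ 3.
lemma2 : (m k n l : ℕ) → 2 ≤ k → n ≡ 2 ^ m → k ∸ 1 ≤ n →
    (Q : Fin l → Subset n → Set) →
    (∀ i e → Q i e → ∣ e ∣ ≡ k ∸ 1) →
    (∀ e → ∣ e ∣ ≡ k ∸ 1 → Σ (Fin l) λ i → Q i e) →
    (∀ i j e → Q i e → Q j e → i ≡ j) →
    (∀ i → Covers (Q i)) →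
    (∀ i t → t ≤ k → ¬ HasSemicycle (k ∸ 1) (Q i) t) →
    (D : Subset l → Set) → IsHypertree k D →
    IsHypertree k (HEdges Q D)
lemma2 m 0 n l () _ _ Q _ _ _ _ _ D _
lemma2 m 1 n l (s≤s ()) _ _ Q _ _ _ _ _ D _
lemma2 m 2 n l _ _ 1≤n Q Q-size Q-partition Q-disjoint Q-covers _ D F-tree =
  Construction.hypertree Q D Q-size Q-disjoint Q-covers (λ i t _ → no-1-semicycle t) F-tree
    (inj₁ (G.no-F-edges (proj₁ F-tree))) (G.base-chain D)
  where module G = GraphCase Q 1≤n Q-size Q-partition Q-disjoint Q-covers
lemma2 m (suc (suc (suc k₃))) n l _ _ k₁≤n Q Q-size Q-partition Q-disjoint Q-covers Q-acyclic D F-tree =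
  Construction.hypertree Q D Q-size Q-disjoint Q-covers Q-acyclic F-tree
    (inj₂ (s≤s (s≤s z≤n))) (base-chain-large Q D k₁≤n Q-partition)
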